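{- Let $G$ be a finite group, $H$ a proper subgroup of $G$, $C$ an inverse-closed subset of $G\setminus\{1\}$, and $\Gamma=\mathrm{Cay}(G,H,C)$. Then $\Gamma$ is triangle-free if and only if $H\cap C\cap C^2=\emptyset$.
   Context: $C$ inverse-closed means $C^{ -1}\subseteq C$. The relative Cayley graph $\Gamma=\mathrm{Cay}(G,H,C)$ is the simple graph with vertex set $G$ in which two distinct vertices $x,y$ are adjacent if and only if at least one of $x,y$ lies in $H$ and $x^{ -1}y\in C$. $C^2=\{ab:a,b\in C\}$. Triangle-free means no three pairwise adjacent vertices. -}

module Defs where

open import Level using (Level; _⊔_; suc)
open import Algebra.Bundles using (Group)
open import Data.Nat using (ℕ)
open import Data.Fin using (Fin)
open import Data.Product using (Σ; ∃; _×_; _,_)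
open import Data.Sum using (_⊎_)
open import Relation.Nullary using (¬_)
open import Relation.Unary using (Pred)

module _ {c ℓ : Level} (G : Group c ℓ) where
  open Group G

  Respects≈ : ∀ {p} → Pred Carrier p → Set (c ⊔ ℓ ⊔ p)
  Respects≈ P = ∀ {x y} → x ≈ y → P x → P y

  FiniteGroup : Set (c ⊔ ℓ)
  FiniteGroup = Σ ℕ λ n → Σ (Fin n → Carrier) λ f → ∀ x → ∃ λ i → f i ≈ x

  record IsSubgroup {p} (H : Pred Carrier p) : Set (c ⊔ ℓ ⊔ p) where
    field
      resp   : Respects≈ H
      has-ε  : H ε
      ∙-closed : ∀ {x y} → H x → H y → H (x ∙ y)
      ⁻¹-closed : ∀ {x} → H x → H (x ⁻¹)

  IsProper : ∀ {p} → Pred Carrier p → Set (c ⊔ p)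
  IsProper H = ∃ λ g → ¬ H g

  record IsConnectionSet {p} (C : Pred Carrier p) : Set (c ⊔ ℓ ⊔ p) where
    field
      resp        : Respects≈ C
      no-identity : ∀ {x} → C x → ¬ (x ≈ ε)
      inv-closed  : ∀ {x} → C x → C (x ⁻¹)

  Adj : ∀ {p q} → Pred Carrier p → Pred Carrier q → Carrier → Carrier → Set (ℓ ⊔ p ⊔ q)
  Adj H C x y = ¬ (x ≈ y) × (H x ⊎ H y) × C (x ⁻¹ ∙ y)

  TriangleFree : ∀ {p q} → Pred Carrier p → Pred Carrier q → Set (c ⊔ ℓ ⊔ p ⊔ q)
  TriangleFree H C = ∀ x y z → ¬ (Adj H C x y × Adj H C y z × Adj H C x z)

  InSquare : ∀ {q} → Pred Carrier q → Pred Carrier (c ⊔ ℓ ⊔ q)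
  InSquare C g = ∃ λ a → ∃ λ b → C a × C b × (a ∙ b) ≈ g

  TripleIntersectionEmpty : ∀ {p q} → Pred Carrier p → Pred Carrier q → Set (c ⊔ ℓ ⊔ p ⊔ q)
  TripleIntersectionEmpty H C = ∀ g → ¬ (H g × C g × InSquare C g)

module Submission where

open import Defs
open import Level using (Level; _⊔_)
open import Algebra.Bundles using (Group)
open import Relation.Unary using (Pred)
open import Function.Bundles using (_⇔_; mk⇔)
open import Data.Product using (_×_; _,_)
open import Data.Sum using (_⊎_; inj₁; inj₂)
import Algebra.Properties.Group as GroupProperties
import Algebra.Properties.Loop as LoopProperties
import Relation.Binary.Reasoning.Setoid as SetoidReasoning

-- Edges of Cay(G,H,C) are labelled by left quotients x \\ y = x⁻¹y.  Labels
-- telescope along a path, so in a triangle u,w,v the label of uv is the product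
-- of two labels in C; if u,v ∈ H it also lies in H.  Every edge has an end in
-- H, so two vertices of any triangle do.  Conversely g = ab ∈ H ∩ C with
-- a,b ∈ C gives the triangle 1, a, g.

two-of-three : ∀ {a b d} {A : Set a} {B : Set b} {D : Set d} →
               A ⊎ B → B ⊎ D → A ⊎ D → (A × B) ⊎ (A × D) ⊎ (B × D)
two-of-three (inj₁ a) (inj₁ b) _        = inj₁ (a , b)
two-of-three (inj₁ a) (inj₂ d) _        = inj₂ (inj₁ (a , d))
two-of-three (inj₂ b) (inj₂ d) _        = inj₂ (inj₂ (b , d))
two-of-three (inj₂ b) (inj₁ _) (inj₁ a) = inj₁ (a , b)
two-of-three (inj₂ b) (inj₁ _) (inj₂ d) = inj₂ (inj₂ (b , d))

module LeftQuotient {c ℓ} (G : Group c ℓ) where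
  open Group G
  open GroupProperties G
  open SetoidReasoning setoid

  \\-telescope : ∀ a b d → (a \\ b) ∙ (b \\ d) ≈ a \\ d
  \\-telescope a b d = begin
    (a \\ b) ∙ (b \\ d)  ≈⟨ assoc (a ⁻¹) b (b \\ d) ⟩
    a \\ (b ∙ (b \\ d))  ≈⟨ ∙-congˡ (\\-leftDividesˡ b d) ⟩
    a \\ d               ∎

  ≈⇒\\≈ε : ∀ {x y} → x ≈ y → x \\ y ≈ ε
  ≈⇒\\≈ε {x} x≈y = trans (∙-congˡ (sym x≈y)) (inverseˡ x)

module RelativeCayley {c ℓ p q} (G : Group c ℓ)
  (H : Pred (Group.Carrier G) p) (H-subgroup : IsSubgroup G H)
  (C : Pred (Group.Carrier G) q) (C-connection : IsConnectionSet G C) where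
  open Group G
  open GroupProperties G
  open LoopProperties loop using (ε\\x≈x)
  open LeftQuotient G
  module H = IsSubgroup H-subgroup
  module C = IsConnectionSet C-connection

  InTripleIntersection : Carrier → Set (c ⊔ ℓ ⊔ p ⊔ q)
  InTripleIntersection g = H g × C g × InSquare G C g

  C-\\-swap : ∀ {x y} → C (x \\ y) → C (y \\ x)
  C-\\-swap {x} {y} x\\y∈C = C.resp (⁻¹-anti-homo-\\ x y) (C.inv-closed x\\y∈C)

  adjacent : ∀ {x y} → H x ⊎ H y → C (x \\ y) → Adj G H C x y
  adjacent x⊎y∈H x\\y∈C = (λ x≈y → C.no-identity x\\y∈C (≈⇒\\≈ε x≈y)) , x⊎y∈H , x\\y∈C

  ε-adjacent : ∀ {x} → C x → Adj G H C ε x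
  ε-adjacent {x} x∈C = adjacent (inj₁ H.has-ε) (C.resp (sym (ε\\x≈x x)) x∈C)

  triangle-on-H-edge : ∀ {u v w} → H u → H v →
    C (u \\ v) → C (u \\ w) → C (w \\ v) → InTripleIntersection (u \\ v)
  triangle-on-H-edge {u} {v} {w} u∈H v∈H u\\v∈C u\\w∈C w\\v∈C =
    H.∙-closed (H.⁻¹-closed u∈H) v∈H , u\\v∈C ,
    (u \\ w , w \\ v , u\\w∈C , w\\v∈C , \\-telescope u w v)

  triangleFree⇒tripleIntersectionEmpty : TriangleFree G H C → TripleIntersectionEmpty G H C
  triangleFree⇒tripleIntersectionEmpty triangleFree g (g∈H , g∈C , a , b , a∈C , b∈C , ab≈g) =
    triangleFree ε a g (ε-adjacent a∈C , a-adjacent-g , ε-adjacent g∈C)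
    where
    a-adjacent-g : Adj G H C a g
    a-adjacent-g = adjacent (inj₂ g∈H) (C.resp (y≈x\\z a b g ab≈g) b∈C)

  tripleIntersectionEmpty⇒triangleFree : TripleIntersectionEmpty G H C → TriangleFree G H C
  tripleIntersectionEmpty⇒triangleFree empty x y z
    ((_ , xy∈H , x\\y∈C) , (_ , yz∈H , y\\z∈C) , (_ , xz∈H , x\\z∈C))
    with two-of-three xy∈H yz∈H xz∈H
  ... | inj₁ (x∈H , y∈H) =
    empty _ (triangle-on-H-edge x∈H y∈H x\\y∈C x\\z∈C (C-\\-swap y\\z∈C))
  ... | inj₂ (inj₁ (x∈H , z∈H)) =
    empty _ (triangle-on-H-edge x∈H z∈H x\\z∈C x\\y∈C y\\z∈C)
  ... | inj₂ (inj₂ (y∈H , z∈H)) =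
    empty _ (triangle-on-H-edge y∈H z∈H y\\z∈C (C-\\-swap x\\y∈C) x\\z∈C)

mainTheorem18 : ∀ {c ℓ p q : Level} (G : Group c ℓ) → FiniteGroup G →
    (H : Pred (Group.Carrier G) p) → IsSubgroup G H → IsProper G H →
    (C : Pred (Group.Carrier G) q) → IsConnectionSet G C →
    TriangleFree G H C ⇔ TripleIntersectionEmpty G H C
mainTheorem18 G _ H H-subgroup _ C C-connection =
  mk⇔ triangleFree⇒tripleIntersectionEmpty tripleIntersectionEmpty⇒triangleFree
  where open RelativeCayley G H H-subgroup C C-connection
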